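{- For all integers $k,\ell\geq 1$, $\alpha(k,\ell)\le (k-1)(\ell-1)+2$; that is, every cyclic permutation of $\{1,\ldots,(k-1)(\ell-1)+2\}$ has an increasing cyclic sub-permutation of length $k+1$ or a decreasing cyclic sub-permutation of length $\ell+1$.
   Context: A cyclic permutation of a finite set of distinct integers is an arrangement of its elements in a circle, written $(j_1,\ldots,j_n)$, up to cyclic rotation; its length is $n$. A cyclic sub-permutation is obtained by deleting some elements and keeping the rest in their cyclic order. A cyclic permutation is increasing if it can be written as $(j_1,\ldots,j_n)$ with $j_1<\cdots<j_n$, and decreasing if it can be written with $j_1>\cdots>j_n$. $\alpha(k,\ell)$ is the smallest positive integer $n$ such that every cyclic permutation of $\{1,\ldots,n\}$ has an increasing cyclic sub-permutation of length $k+1$ or a decreasing cyclic sub-permutation of length $\ell+1$. -}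

module Defs where

open import Data.Nat using (ℕ; suc; _<_; _>_)
open import Data.List using (List; _++_; map; upTo; length)
open import Data.List.Relation.Unary.Linked using (Linked)
open import Data.List.Relation.Binary.Permutation.Propositional using (_↭_)
open import Data.List.Relation.Binary.Sublist.Propositional using (_⊆_)
open import Data.Product using (Σ; ∃; _×_)
open import Relation.Binary.PropositionalEquality using (_≡_)

-- A cyclic permutation of {1,…,n} is represented by any linear list
-- reading it off the circle from some starting point; all notions below
-- are invariant under rotation.
IsCyclicPermOf : ℕ → List ℕ → Set
IsCyclicPermOf n xs = xs ↭ map suc (upTo n)

CycIncreasing : List ℕ → Set
CycIncreasing xs = Σ (List ℕ) λ as → Σ (List ℕ) λ bs →
  (xs ≡ as ++ bs) × Linked _<_ (bs ++ as)

CycDecreasing : List ℕ → Set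
CycDecreasing xs = Σ (List ℕ) λ as → Σ (List ℕ) λ bs →
  (xs ≡ as ++ bs) × Linked _>_ (bs ++ as)

-- Cyclic sub-permutations of the cyclic arrangement represented by xs are
-- exactly (rotations of) subsequences ys of xs.
HasIncCycSub : ℕ → List ℕ → Set
HasIncCycSub m xs = ∃ λ ys → ys ⊆ xs × length ys ≡ m × CycIncreasing ys

HasDecCycSub : ℕ → List ℕ → Set
HasDecCycSub m xs = ∃ λ ys → ys ⊆ xs × length ys ≡ m × CycDecreasing ys

module Submission where

-- Idea: cut the circle just after its maximum n.  What remains, read
-- clockwise from n, is a linear word w of length (k-1)(ℓ-1)+1 whose entries
-- are distinct and smaller than n.  By the Erdős–Szekeres theorem w has an
-- increasing subsequence of length k or a decreasing one of length ℓ.  Going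
-- around the circle, an increasing subsequence of w followed by n, and n
-- followed by a decreasing subsequence of w, are cyclically monotone; this
-- adds the missing element.

open import Defs
open import Data.Nat using (ℕ; zero; suc; pred; _+_; _*_; _∸_; _≤_; _<_; _≥_; _>_; _≤?_)
open import Data.Nat.Properties
open import Data.List using (List; []; _∷_; _++_; [_]; map; upTo; length; take)
open import Data.List.Properties
  using (length-take; length-map; length-upTo; length-++-sucʳ; length-++-comm; ++-assoc)
open import Data.List.Relation.Unary.All using (All; []; _∷_)
import Data.List.Relation.Unary.All as All
open import Data.List.Relation.Unary.All.Properties using (all-upTo) renaming (map⁺ to All-map⁺)
open import Data.List.Relation.Unary.AllPairs using (AllPairs; []; _∷_)
open import Data.List.Relation.Unary.Linked using (Linked; []; [-]; _∷_)
open import Data.List.Relation.Unary.Unique.Propositional using (Unique)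
import Data.List.Relation.Unary.Unique.Propositional.Properties as Unique
open import Data.List.Membership.Propositional.Properties using (∈-∃++; ∈-map⁺; ∈-upTo⁺)
open import Data.List.Relation.Binary.Permutation.Propositional using (_↭_; prep; ↭-sym; ↭-trans; ↭⇒↭ₛ)
open import Data.List.Relation.Binary.Permutation.Propositional.Properties
  using (All-resp-↭; ∈-resp-↭; ↭-length; shift; ++-comm)
open import Data.List.Relation.Binary.Permutation.Setoid.Properties using (Unique-resp-↭)
open import Data.List.Relation.Binary.Sublist.Propositional using (_⊆_; []; _∷_; _∷ʳ_; ⊆-trans; minimum)
open import Data.List.Relation.Binary.Sublist.Propositional.Properties
  using (All-resp-⊆; take-⊆) renaming (++⁺ to ⊆-++⁺)
open import Data.Product using (∃; ∃₂; _×_; _,_; proj₂)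
open import Data.Sum using (_⊎_; inj₁; inj₂)
open import Data.Empty using (⊥-elim)
open import Relation.Nullary using (yes; no)
open import Relation.Binary.PropositionalEquality
  using (_≡_; refl; sym; trans; cong; subst; ≢-sym; setoid)

Chain : {A : Set} → (A → A → Set) → ℕ → List A → Set
Chain R m w = ∃ λ s → s ⊆ w × length s ≡ m × Linked R s

chain-⊆ : ∀ {A : Set} {R : A → A → Set} {m v w} → v ⊆ w → Chain R m v → Chain R m w
chain-⊆ v⊆w (s , s⊆v , len , linked) = s , ⊆-trans s⊆v v⊆w , len , linked

take-linked : ∀ {A : Set} {R : A → A → Set} n {xs : List A} → Linked R xs → Linked R (take n xs)
take-linked zero          _        = []
take-linked (suc n)       []       = []
take-linked (suc zero)    [-]      = [-]
take-linked (suc (suc n)) [-]      = [-]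
take-linked (suc zero)    (_ ∷ _)  = [-]
take-linked (suc (suc n)) (r ∷ rs) = r ∷ take-linked (suc n) rs

shorten : ∀ {A : Set} {R : A → A → Set} m {s : List A} → m ≤ length s → Linked R s → Chain R m s
shorten m {s} m≤|s| linked =
  take m s , take-⊆ m s , trans (length-take m s) (m≤n⇒m⊓n≡m m≤|s|) , take-linked m linked

AllPairs-resp-⊇ : ∀ {A : Set} {R : A → A → Set} {xs ys} → xs ⊆ ys → AllPairs R ys → AllPairs R xs
AllPairs-resp-⊇ []         _          = []
AllPairs-resp-⊇ (_ ∷ʳ sub) (_ ∷ ps)   = AllPairs-resp-⊇ sub ps
AllPairs-resp-⊇ (refl ∷ sub) (p ∷ ps) = All-resp-⊆ sub p ∷ AllPairs-resp-⊇ sub ps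

snoc-linked : ∀ {A : Set} {R : A → A → Set} {xs : List A} {y} →
  Linked R xs → All (λ x → R x y) xs → Linked R (xs ++ [ y ])
snoc-linked []       []            = [-]
snoc-linked [-]      (r ∷ [])      = r ∷ [-]
snoc-linked (r ∷ rs) (_ ∷ related) = r ∷ snoc-linked rs related

cons-linked : ∀ {A : Set} {R : A → A → Set} {xs : List A} {y} →
  All (R y) xs → Linked R xs → Linked R (y ∷ xs)
cons-linked []      []     = [-]
cons-linked (r ∷ _) linked = r ∷ linked

split-sublist : ∀ {A : Set} (xs ys s : List A) → s ⊆ xs ++ ys →
  ∃₂ λ sx sy → s ≡ sx ++ sy × sx ⊆ xs × sy ⊆ ys
split-sublist []       ys s       sub          = [] , s , refl , [] , sub
split-sublist (x ∷ xs) ys s       (.x ∷ʳ sub)  with split-sublist xs ys s sub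
... | sx , sy , refl , sx⊆xs , sy⊆ys = sx , sy , refl , x ∷ʳ sx⊆xs , sy⊆ys
split-sublist (x ∷ xs) ys (.x ∷ s) (refl ∷ sub) with split-sublist xs ys s sub
... | sx , sy , refl , sx⊆xs , sy⊆ys = x ∷ sx , sy , refl , refl ∷ sx⊆xs , sy⊆ys

weak⇒strict : ∀ {xs : List ℕ} → Linked _≥_ xs → Unique xs → Linked _>_ xs
weak⇒strict []       _                  = []
weak⇒strict [-]      _                  = [-]
weak⇒strict (x≥y ∷ rs) ((x≢y ∷ _) ∷ uniq) = ≤∧≢⇒< x≥y (≢-sym x≢y) ∷ weak⇒strict rs uniq

-- Records t w C R: scanning w with a running threshold (initially t), C
-- collects the entries reaching the threshold, each of which raises it past
-- itself, and R collects the remaining entries.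
data Records : ℕ → List ℕ → List ℕ → List ℕ → Set where
  []   : ∀ {t} → Records t [] [] []
  high : ∀ {t x w C R} → t ≤ x → Records (suc x) w C R → Records t (x ∷ w) (x ∷ C) R
  low  : ∀ {t x w C R} → x < t → Records t w C R → Records t (x ∷ w) C (x ∷ R)

records : ∀ t w → ∃₂ (Records t w)
records t []      = [] , [] , []
records t (x ∷ w) with t ≤? x
... | yes t≤x = let (C , R , rs) = records (suc x) w in x ∷ C , R , high t≤x rs
... | no  t≰x = let (C , R , rs) = records t w in C , x ∷ R , low (≰⇒> t≰x) rs

records-length : ∀ {t w C R} → Records t w C R → length C + length R ≡ length w
records-length []                        = refl
records-length (high _ rs)               = cong suc (records-length rs)
records-length {C = C} {x ∷ R} (low _ rs) =
  trans (+-suc (length C) (length R)) (cong suc (records-length rs))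

records-⊆ : ∀ {t w C R} → Records t w C R → C ⊆ w
records-⊆ []                = []
records-⊆ (high _ rs)       = refl ∷ records-⊆ rs
records-⊆ (low {x = x} _ rs) = x ∷ʳ records-⊆ rs

rest-⊆ : ∀ {t w C R} → Records t w C R → R ⊆ w
rest-⊆ []                 = []
rest-⊆ (high {x = x} _ rs) = x ∷ʳ rest-⊆ rs
rest-⊆ (low _ rs)         = refl ∷ rest-⊆ rs

records-increasing : ∀ {t w C R} → Records t w C R → All (t ≤_) C × Linked _<_ C
records-increasing []                     = [] , []
records-increasing (high {C = []} t≤x rs) = t≤x ∷ [] , [-]
records-increasing (high {C = c ∷ C} t≤x rs) with records-increasing rs
... | x<c ∷ x<C , linked =
  t≤x ∷ All.map (λ x<y → ≤-trans t≤x (<⇒≤ x<y)) (x<c ∷ x<C) , x<c ∷ linked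
records-increasing (low _ rs)             = records-increasing rs

-- Each non-record x is preceded in w by a record y ≥ x (the current
-- threshold-setter), unless x is below the initial threshold.  It is stated
-- for a subsequence x ∷ s of R so that y can be put in front of it.
rest-dominated : ∀ {t w C R x s} → Records t w C R → x ∷ s ⊆ R →
  (∃ λ y → y ∷ x ∷ s ⊆ w × x ≤ y) ⊎ (x < t × x ∷ s ⊆ w)
rest-dominated []                 ()
rest-dominated (high {x = y} _ rs) sub with rest-dominated rs sub
... | inj₁ (z , sub′ , x≤z) = inj₁ (z , y ∷ʳ sub′ , x≤z)
... | inj₂ (x<suc-y , sub′) = inj₁ (y , refl ∷ sub′ , ≤-pred x<suc-y)
rest-dominated (low x<t rs) (refl ∷ sub) = inj₂ (x<t , refl ∷ ⊆-trans sub (rest-⊆ rs))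
rest-dominated (low {x = y} _ rs) (.y ∷ʳ sub) with rest-dominated rs sub
... | inj₁ (z , sub′ , x≤z) = inj₁ (z , y ∷ʳ sub′ , x≤z)
... | inj₂ (x<t , sub′)     = inj₂ (x<t , y ∷ʳ sub′)

rest-long : ∀ a b {c r n} → c ≤ a → a * suc b < n → c + r ≡ n → a * b < r
rest-long a b {c} {r} {n} c≤a long split = +-cancelˡ-< c (a * b) r (begin-strict
  c + a * b  ≤⟨ +-monoˡ-≤ (a * b) c≤a ⟩
  a + a * b  ≡⟨ sym (*-suc a b) ⟩
  a * suc b  <⟨ long ⟩
  n          ≡⟨ sym split ⟩
  c + r      ∎)
  where open ≤-Reasoning

-- Erdős–Szekeres: a word longer than a * b has a strictly increasing chain
-- of length a + 1 or a weakly decreasing chain of length b + 1.  Induction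
-- on b: if the records do not already give the increasing chain, apply the
-- hypothesis to the non-records and put a record in front of a decreasing
-- chain found there.
erdős-szekeres : ∀ a b (w : List ℕ) → a * b < length w → Chain _<_ (suc a) w ⊎ Chain _≥_ (suc b) w
erdős-szekeres a zero []      long = ⊥-elim (n≮0 (subst (_< 0) (*-zeroʳ a) long))
erdős-szekeres a zero (x ∷ w) _    = inj₂ ([ x ] , refl ∷ minimum w , refl , [-])
erdős-szekeres a (suc b) w long with records 0 w
... | C , R , rs with suc a ≤? length C
...   | yes a<|C| = inj₁ (chain-⊆ (records-⊆ rs) (shorten (suc a) a<|C| (proj₂ (records-increasing rs))))
...   | no  a≮|C| with erdős-szekeres a b R (rest-long a b (≮⇒≥ a≮|C|) long (records-length rs))
...     | inj₁ increasing              = inj₁ (chain-⊆ (rest-⊆ rs) increasing)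
...     | inj₂ ([] , _ , () , _)
...     | inj₂ (x ∷ s , x∷s⊆R , len , decreasing) with rest-dominated rs x∷s⊆R
...       | inj₁ (y , sub , x≤y) = inj₂ (y ∷ x ∷ s , sub , cong suc len , x≤y ∷ decreasing)
...       | inj₂ (() , _)

inserted-length : ∀ (sA sB : List ℕ) n → length (sA ++ n ∷ sB) ≡ suc (length (sB ++ sA))
inserted-length sA sB n = trans (length-++-sucʳ sA n sB) (cong suc (length-++-comm sA sB))

close-increasing : ∀ {n m} A B → All (_< n) (B ++ A) → Chain _<_ m (B ++ A) →
  HasIncCycSub (suc m) (A ++ [ n ] ++ B)
close-increasing {n} A B below (s , s⊆w , refl , increasing) with split-sublist B A s s⊆w
... | sB , sA , refl , sB⊆B , sA⊆A =
  sA ++ n ∷ sB , ⊆-++⁺ sA⊆A (refl ∷ sB⊆B) , inserted-length sA sB n ,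
  sA ++ [ n ] , sB , sym (++-assoc sA [ n ] sB) ,
  subst (Linked _<_) (++-assoc sB sA [ n ]) (snoc-linked increasing (All-resp-⊆ s⊆w below))

close-decreasing : ∀ {n m} A B → All (_< n) (B ++ A) → Chain _>_ m (B ++ A) →
  HasDecCycSub (suc m) (A ++ [ n ] ++ B)
close-decreasing {n} A B below (s , s⊆w , refl , decreasing) with split-sublist B A s s⊆w
... | sB , sA , refl , sB⊆B , sA⊆A =
  sA ++ n ∷ sB , ⊆-++⁺ sA⊆A (refl ∷ sB⊆B) , inserted-length sA sB n ,
  sA , n ∷ sB , refl , cons-linked (All-resp-⊆ s⊆w below) decreasing

cut-at-maximum : ∀ m {xs} → IsCyclicPermOf (suc m) xs → ∃₂ λ A B →
  xs ≡ A ++ [ suc m ] ++ B × All (_< suc m) (B ++ A) × Unique (B ++ A) × length (B ++ A) ≡ m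
cut-at-maximum m xs↭ with ∈-∃++ (∈-resp-↭ (↭-sym xs↭) (∈-map⁺ suc (∈-upTo⁺ ≤-refl)))
... | A , B , refl = A , B , refl , below , unique-rest , length-rest
  where
  rotated : suc m ∷ B ++ A ↭ map suc (upTo (suc m))
  rotated = ↭-trans (prep (suc m) (++-comm B A)) (↭-trans (↭-sym (shift (suc m) A B)) xs↭)

  unique : Unique (suc m ∷ B ++ A)
  unique = Unique-resp-↭ (setoid ℕ) (↭⇒↭ₛ (↭-sym rotated))
             (Unique.map⁺ suc-injective (Unique.upTo⁺ (suc m)))

  unique-rest : Unique (B ++ A)
  unique-rest with unique
  ... | _ ∷ uniq = uniq

  below : All (_< suc m) (B ++ A)
  below with unique | All-resp-↭ (↭-sym rotated) (All-map⁺ (all-upTo (suc m)))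
  ... | distinct ∷ _ | _ ∷ bounded =
    All.zipWith (λ (x≤ , x≢) → ≤∧≢⇒< x≤ (≢-sym x≢)) (bounded , distinct)

  length-rest : length (B ++ A) ≡ m
  length-rest = cong pred (trans (↭-length rotated)
                  (trans (length-map suc (upTo (suc m))) (length-upTo (suc m))))

lemma1 : (k ℓ : ℕ) → 1 ≤ k → 1 ≤ ℓ → (xs : List ℕ) →
    IsCyclicPermOf ((k ∸ 1) * (ℓ ∸ 1) + 2) xs →
    HasIncCycSub (suc k) xs ⊎ HasDecCycSub (suc ℓ) xs
lemma1 (suc k) (suc ℓ) _ _ xs xs↭
  with cut-at-maximum (suc (k * ℓ)) (subst (λ n → IsCyclicPermOf n xs) (+-comm (k * ℓ) 2) xs↭)
... | A , B , refl , below , unique , length-rest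
  with erdős-szekeres k ℓ (B ++ A) (subst (k * ℓ <_) (sym length-rest) ≤-refl)
...   | inj₁ increasing = inj₁ (close-increasing A B below increasing)
...   | inj₂ (s , s⊆w , len , decreasing) =
  inj₂ (close-decreasing A B below
         (s , s⊆w , len , weak⇒strict decreasing (AllPairs-resp-⊇ s⊆w unique)))
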